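{- Let $G$ be a finite simple graph, let $\{x,y\}\subseteq V(G)$ be a determining set of $G$, and let $d_1,d_2,d_3,d_4\in V(G)\setminus\{x,y\}$ be pairwise distinct vertices such that some automorphism of $G$ swaps $x$ and $y$, swaps $d_1$ and $d_2$, and swaps $d_3$ and $d_4$. Let $i,j\in\{1,2,3,4\}$ with $i\neq j$. If some automorphism of $G$ swaps $x$ and $d_i$ and fixes $y$, then: (i) there is no automorphism of $G$ that fixes $y$ and has a 3-cycle $x\mapsto d_i\mapsto d_j\mapsto x$, and none that fixes $y$ and has a 3-cycle $x\mapsto d_j\mapsto d_i\mapsto x$; (ii) there is no automorphism of $G$ that fixes $x$ and has a 3-cycle $y\mapsto d_i\mapsto d_j\mapsto y$, and none that fixes $x$ and has a 3-cycle $y\mapsto d_j\mapsto d_i\mapsto y$.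
   Context: A set $S\subseteq V(G)$ is a determining set if the only automorphism of $G$ fixing every vertex of $S$ is the identity. -}

module Defs where

open import Data.Nat using (ℕ)
open import Data.Fin using (Fin)
open import Data.Product using (_×_)
open import Relation.Binary.PropositionalEquality using (_≡_)
open import Relation.Nullary using (¬_; Dec)
open import Level using (0ℓ; suc)

record Graph (n : ℕ) : Set₁ where
  field
    Adj    : Fin n → Fin n → Set
    sym    : ∀ {u v} → Adj u v → Adj v u
    irrefl : ∀ {u} → ¬ Adj u u
    dec    : ∀ u v → Dec (Adj u v)
open Graph public

record Automorphism {n : ℕ} (G : Graph n) : Set where
  field
    fun      : Fin n → Fin n
    inv      : Fin n → Fin n
    inv-left : ∀ v → inv (fun v) ≡ v
    inv-right : ∀ v → fun (inv v) ≡ v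
    preserves : ∀ u v → (Adj G u v → Adj G (fun u) (fun v)) × (Adj G (fun u) (fun v) → Adj G u v)
open Automorphism public

IsDeterminingSet : {n : ℕ} (G : Graph n) → (Fin n → Set) → Set
IsDeterminingSet G S = (σ : Automorphism G) → (∀ v → S v → fun σ v ≡ v) → ∀ v → fun σ v ≡ v

Swaps : {n : ℕ} {G : Graph n} → Automorphism G → Fin n → Fin n → Set
Swaps σ a b = (fun σ a ≡ b) × (fun σ b ≡ a)

Has3Cycle : {n : ℕ} {G : Graph n} → Automorphism G → Fin n → Fin n → Fin n → Set
Has3Cycle σ a b c = (fun σ a ≡ b) × (fun σ b ≡ c) × (fun σ c ≡ a)

{-# OPTIONS --safe #-}
module Submission where

open import Defs hiding (sym)
open import Data.Nat using (ℕ)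
open import Data.Fin using (Fin; zero; suc)
open import Data.Product using (_×_; Σ; _,_; proj₁; proj₂)
open import Data.Sum using (_⊎_; inj₁; inj₂)
open import Function using (_∘_)
open import Relation.Binary.PropositionalEquality
  using (_≡_; _≢_; _≗_; refl; sym; trans; cong; subst₂; module ≡-Reasoning)
open import Relation.Nullary using (¬_)

-- Since {x, y} is determining, automorphisms agreeing on x and y are equal.
-- (i) An automorphism ρ fixing y with x ↦ d_i agrees with τ on {x, y}, so ρ = τ
-- and ρ(d_i) = x, not d_j. (ii) If ρ fixes x and cycles y ↦ d_i ↦ d_j ↦ y, then
-- τρ and ρσ agree on {x, y}, so τρ = ρσ; evaluating at d_j gives ρ(σ d_j) = y = ρ(d_j),
-- i.e. σ fixes d_j, whereas σ swaps d_j with another d_k. In both parts the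
-- reversed cycle is handled by passing to ρ⁻¹.

module _ {n : ℕ} {G : Graph n} where

  infixr 9 _∘ᴬ_

  _∘ᴬ_ : Automorphism G → Automorphism G → Automorphism G
  f ∘ᴬ g = record
    { fun       = fun f ∘ fun g
    ; inv       = inv g ∘ inv f
    ; inv-left  = λ v → trans (cong (inv g) (inv-left f (fun g v))) (inv-left g v)
    ; inv-right = λ v → trans (cong (fun f) (inv-right g (inv f v))) (inv-right f v)
    ; preserves = λ u v →
        (proj₁ (preserves f _ _) ∘ proj₁ (preserves g u v)) ,
        (proj₂ (preserves g u v) ∘ proj₂ (preserves f _ _))
    }

  _⁻¹ᴬ : Automorphism G → Automorphism G
  f ⁻¹ᴬ = record
    { fun       = inv f
    ; inv       = fun f
    ; inv-left  = inv-right f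
    ; inv-right = inv-left f
    ; preserves = λ u v →
        (λ a → proj₂ (preserves f (inv f u) (inv f v))
                 (subst₂ (Adj G) (sym (inv-right f u)) (sym (inv-right f v)) a)) ,
        (λ a → subst₂ (Adj G) (inv-right f u) (inv-right f v)
                 (proj₁ (preserves f (inv f u) (inv f v)) a))
    }

  fun≡⇒inv≡ : (f : Automorphism G) {a b : Fin n} → fun f a ≡ b → inv f b ≡ a
  fun≡⇒inv≡ f {a} refl = inv-left f a

  fun-injective : (f : Automorphism G) {a b : Fin n} → fun f a ≡ fun f b → a ≡ b
  fun-injective f {a} {b} eq = trans (sym (fun≡⇒inv≡ f eq)) (inv-left f b)

  Has3Cycle-⁻¹ : (ρ : Automorphism G) {a b c : Fin n} →
                 Has3Cycle ρ a b c → Has3Cycle (ρ ⁻¹ᴬ) a c b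
  Has3Cycle-⁻¹ ρ (ρa , ρb , ρc) = fun≡⇒inv≡ ρ ρc , fun≡⇒inv≡ ρ ρb , fun≡⇒inv≡ ρ ρa

  determining⇒≗ : {S : Fin n → Set} → IsDeterminingSet G S →
                  (f g : Automorphism G) → (∀ v → S v → fun f v ≡ fun g v) →
                  fun f ≗ fun g
  determining⇒≗ {S} det f g agree v =
    trans (sym (inv-right g (fun f v))) (cong (fun g) (det (g ⁻¹ᴬ ∘ᴬ f) fixes v))
    where
    fixes : ∀ w → S w → inv g (fun f w) ≡ w
    fixes w w∈S = fun≡⇒inv≡ g (sym (agree w w∈S))

  module _ {x y : Fin n} (det : IsDeterminingSet G (λ v → (v ≡ x) ⊎ (v ≡ y))) where

    agree-on-pair⇒≗ : (f g : Automorphism G) →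
                      fun f x ≡ fun g x → fun f y ≡ fun g y → fun f ≗ fun g
    agree-on-pair⇒≗ f g fx fy = determining⇒≗ det f g agree
      where
      agree : ∀ v → (v ≡ x) ⊎ (v ≡ y) → fun f v ≡ fun g v
      agree v (inj₁ refl) = fx
      agree v (inj₂ refl) = fy

    module _ (τ : Automorphism G) {a : Fin n} (τ-swaps : Swaps τ x a) (τy : fun τ y ≡ y) where

      3-cycle-fixing-y-degenerate : (ρ : Automorphism G) {b : Fin n} →
                                    fun ρ y ≡ y → Has3Cycle ρ x a b → b ≡ x
      3-cycle-fixing-y-degenerate ρ {b} ρy (ρx , ρa , _) = begin
        b           ≡⟨ sym ρa ⟩
        fun ρ a     ≡⟨ agree-on-pair⇒≗ ρ τ (trans ρx (sym (proj₁ τ-swaps))) (trans ρy (sym τy)) a ⟩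
        fun τ a     ≡⟨ proj₂ τ-swaps ⟩
        x           ∎
        where open ≡-Reasoning

      3-cycle-fixing-x⇒swap-fixes : (σ ρ : Automorphism G) {b : Fin n} → Swaps σ x y →
                                    fun ρ x ≡ x → Has3Cycle ρ y a b → fun σ b ≡ b
      3-cycle-fixing-x⇒swap-fixes σ ρ {b} (σx , σy) ρx (ρy , _ , ρb) =
        fun-injective ρ (begin
          fun ρ (fun σ b) ≡⟨ sym (τρ≗ρσ b) ⟩
          fun τ (fun ρ b) ≡⟨ cong (fun τ) ρb ⟩
          fun τ y         ≡⟨ τy ⟩
          y               ≡⟨ sym ρb ⟩
          fun ρ b         ∎)
        where
        open ≡-Reasoning
        τρ≗ρσ : fun (τ ∘ᴬ ρ) ≗ fun (ρ ∘ᴬ σ)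
        τρ≗ρσ = agree-on-pair⇒≗ (τ ∘ᴬ ρ) (ρ ∘ᴬ σ)
          (trans (cong (fun τ) ρx) (trans (proj₁ τ-swaps) (sym (trans (cong (fun ρ) σx) ρy))))
          (trans (cong (fun τ) ρy) (trans (proj₂ τ-swaps) (sym (trans (cong (fun ρ) σy) ρx))))

partner : Fin 4 → Fin 4
partner zero                   = suc zero
partner (suc zero)             = zero
partner (suc (suc zero))       = suc (suc (suc zero))
partner (suc (suc (suc zero))) = suc (suc zero)

partner≢ : ∀ k → partner k ≢ k
partner≢ zero                   ()
partner≢ (suc zero)             ()
partner≢ (suc (suc zero))       ()
partner≢ (suc (suc (suc zero))) ()

proposition8 : {n : ℕ} (G : Graph n) (x y : Fin n)
    → IsDeterminingSet G (λ v → (v ≡ x) ⊎ (v ≡ y))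
    → (d : Fin 4 → Fin n)
    → (∀ k → (d k ≢ x) × (d k ≢ y))
    → (∀ k l → d k ≡ d l → k ≡ l)
    → Σ (Automorphism G) (λ σ → Swaps σ x y × Swaps σ (d (zero)) (d (suc zero)) × Swaps σ (d (suc (suc zero))) (d (suc (suc (suc zero)))))
    → (i j : Fin 4) → i ≢ j
    → Σ (Automorphism G) (λ τ → Swaps τ x (d i) × (fun τ y ≡ y))
    → (¬ Σ (Automorphism G) (λ ρ → (fun ρ y ≡ y) × Has3Cycle ρ x (d i) (d j))
    × ¬ Σ (Automorphism G) (λ ρ → (fun ρ y ≡ y) × Has3Cycle ρ x (d j) (d i)))
    × (¬ Σ (Automorphism G) (λ ρ → (fun ρ x ≡ x) × Has3Cycle ρ y (d i) (d j))
    × ¬ Σ (Automorphism G) (λ ρ → (fun ρ x ≡ x) × Has3Cycle ρ y (d j) (d i)))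
proposition8 G x y det d d∉xy d-injective (σ , σ-swaps-xy , σ01 , σ23) i j _ (τ , τ-swaps , τy) =
  (ρ-fixing-y-absurd , λ (ρ , ρy , c) → ρ-fixing-y-absurd (ρ ⁻¹ᴬ , fun≡⇒inv≡ ρ ρy , Has3Cycle-⁻¹ ρ c)) ,
  (ρ-fixing-x-absurd , λ (ρ , ρx , c) → ρ-fixing-x-absurd (ρ ⁻¹ᴬ , fun≡⇒inv≡ ρ ρx , Has3Cycle-⁻¹ ρ c))
  where
  σ-moves-d : ∀ k → fun σ (d k) ≢ d k
  σ-moves-d k = partner≢ k ∘ d-injective (partner k) k ∘ trans (sym (σd k))
    where
    σd : ∀ k → fun σ (d k) ≡ d (partner k)
    σd zero                   = proj₁ σ01
    σd (suc zero)             = proj₂ σ01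
    σd (suc (suc zero))       = proj₁ σ23
    σd (suc (suc (suc zero))) = proj₂ σ23

  ρ-fixing-y-absurd : ¬ Σ (Automorphism G) (λ ρ → (fun ρ y ≡ y) × Has3Cycle ρ x (d i) (d j))
  ρ-fixing-y-absurd (ρ , ρy , c) =
    proj₁ (d∉xy j) (3-cycle-fixing-y-degenerate det τ τ-swaps τy ρ ρy c)

  ρ-fixing-x-absurd : ¬ Σ (Automorphism G) (λ ρ → (fun ρ x ≡ x) × Has3Cycle ρ y (d i) (d j))
  ρ-fixing-x-absurd (ρ , ρx , c) =
    σ-moves-d j (3-cycle-fixing-x⇒swap-fixes det τ τ-swaps τy σ ρ σ-swaps-xy ρx c)
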